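{- Let $\Phi=(A;\{E_i\}_{i=0}^d;A^*;\{E^*_i\}_{i=0}^d)$ be a tridiagonal system on $V$ with diameter $d\geq1$ that has $q$-Serre type. Then $[A,[A,[A,A^*]_b]_{b^{ -1}}]=0$ and $[A^*,[A^*,[A^*,A]_b]_{b^{ -1}}]=0$.
   Context: $\mathbb F$ is a field, $V$ a nonzero finite-dimensional $\mathbb F$-vector space. A TD pair on $V$ is an ordered pair $A,A^*\in\mathrm{End}(V)$ such that: each is diagonalizable; for some ordering $\{V_i\}_{i=0}^d$ of the eigenspaces of $A$, $A^*V_i\subseteq V_{i-1}+V_i+V_{i+1}$ ($V_{ -1}=V_{d+1}=0$); for some ordering $\{V^*_i\}_{i=0}^\delta$ of the eigenspaces of $A^*$, $AV^*_i\subseteq V^*_{i-1}+V^*_i+V^*_{i+1}$; and no subspace other than $0,V$ is invariant under both $A$ and $A^*$. Such orderings are standard. A TD system is $(A;\{E_i\}_{i=0}^d;A^*;\{E^*_i\}_{i=0}^\delta)$ with $A,A^*$ a TD pair and $\{E_i\}$, $\{E^*_i\}$ the primitive idempotents of $A$, $A^*$ in standard orderings; one has $d=\delta$. $\theta_i$ (resp. $\theta^*_i$) is the eigenvalue of $A$ for $E_i$ (resp. $A^*$ for $E^*_i$). Fix nonzero $q$ in the algebraic closure of $\mathbb F$, not a root of unity, with $b=q^2\in\mathbb F$. $\Phi$ has $q$-Serre type if $\theta_i=b\theta_{i-1}$ and $\theta^*_i=b^{ -1}\theta^*_{i-1}$ for $1\le i\le d$. $[X,Y]=XY-YX$, $[X,Y]_b=bXY-YX$.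 -}

module Defs where

open import Level using (Level; _⊔_)
open import Data.Nat using (ℕ; zero; suc)
open import Data.Fin using (Fin; zero; suc; toℕ; inject₁)
open import Data.Product using (Σ; ∃; _×_; _,_)
open import Relation.Nullary using (¬_)
import Data.Fin
import Data.Nat
import Data.Sum
import Relation.Nullary
open import Relation.Binary.PropositionalEquality using (_≡_)
open import Algebra.Bundles using (CommutativeRing)

record Field (c ℓ : Level) : Set (Level.suc (c ⊔ ℓ)) where
  field
    commutativeRing : CommutativeRing c ℓ
  open CommutativeRing commutativeRing public
  field
    0≉1     : ¬ (0# ≈ 1#)
    inverse : ∀ x → ¬ (x ≈ 0#) → ∃ λ y → (x * y) ≈ 1#

module FieldTheory {c ℓ : Level} (F : Field c ℓ) where
  open Field F using (Carrier; _≈_; _+_; _*_; _-_; 0#; 1#)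

  Σ[<_] : (n : ℕ) → (Fin n → Carrier) → Carrier
  Σ[< zero  ] f = 0#
  Σ[< suc n ] f = f zero + Σ[< n ] (λ i → f (suc i))

  infixr 8 _^_
  _^_ : Carrier → ℕ → Carrier
  x ^ zero  = 1#
  x ^ suc k = x * (x ^ k)

  Vec : ℕ → Set c
  Vec n = Fin n → Carrier

  Mat : ℕ → Set c
  Mat n = Fin n → Fin n → Carrier

  module _ {n : ℕ} where
    _≈V_ : Vec n → Vec n → Set ℓ
    u ≈V v = ∀ i → u i ≈ v i

    _≈M_ : Mat n → Mat n → Set ℓ
    X ≈M Y = ∀ i j → X i j ≈ Y i j

    0V : Vec n
    0V _ = 0#

    _+V_ : Vec n → Vec n → Vec n
    (u +V v) i = u i + v i

    _·V_ : Carrier → Vec n → Vec n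
    (a ·V v) i = a * v i

    0M : Mat n
    0M _ _ = 0#

    IM : Mat n
    IM i j with i Data.Fin.≟ j
    ... | Relation.Nullary.yes _ = 1#
    ... | Relation.Nullary.no  _ = 0#

    _+M_ : Mat n → Mat n → Mat n
    (X +M Y) i j = X i j + Y i j

    _-M_ : Mat n → Mat n → Mat n
    (X -M Y) i j = X i j - Y i j

    _·M_ : Carrier → Mat n → Mat n
    (a ·M X) i j = a * X i j

    _∘M_ : Mat n → Mat n → Mat n
    (X ∘M Y) i j = Σ[< n ] (λ k → X i k * Y k j)

    _$_ : Mat n → Vec n → Vec n
    (X $ v) i = Σ[< n ] (λ k → X i k * v k)

    ΣM : (m : ℕ) → (Fin m → Mat n) → Mat n
    ΣM m f i j = Σ[< m ] (λ k → f k i j)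

    [_,_] : Mat n → Mat n → Mat n
    [ X , Y ] = (X ∘M Y) -M (Y ∘M X)

    [_,_]⟨_⟩ : Mat n → Mat n → Carrier → Mat n
    [ X , Y ]⟨ a ⟩ = (a ·M (X ∘M Y)) -M (Y ∘M X)

    record PrimitiveIdempotents (X : Mat n) (d : ℕ)
        (E : Fin (suc d) → Mat n) (θ : Fin (suc d) → Carrier) : Set (c ⊔ ℓ) where
      field
        idem      : ∀ i → (E i ∘M E i) ≈M E i
        orth      : ∀ i j → ¬ (i ≡ j) → (E i ∘M E j) ≈M 0M
        nonzero   : ∀ i → ¬ (E i ≈M 0M)
        resolution : ΣM (suc d) E ≈M IM
        spectral  : X ≈M ΣM (suc d) (λ i → θ i ·M E i)
        distinct  : ∀ i j → ¬ (i ≡ j) → ¬ (θ i ≈ θ j)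

    record IsSubspace (W : Vec n → Set (c ⊔ ℓ)) : Set (c ⊔ ℓ) where
      field
        resp  : ∀ {u v} → u ≈V v → W u → W v
        has0  : W 0V
        plus  : ∀ {u v} → W u → W v → W (u +V v)
        scale : ∀ a {v} → W v → W (a ·V v)

    Invariant : Mat n → (Vec n → Set (c ⊔ ℓ)) → Set (c ⊔ ℓ)
    Invariant X W = ∀ v → W v → W (X $ v)

  FarApart : {m : ℕ} → Fin m → Fin m → Set
  FarApart i j = (suc (toℕ i) Data.Nat.< toℕ j) Data.Sum.⊎ (suc (toℕ j) Data.Nat.< toℕ i)

  -- Tridiagonal system on V = F^n (n ≥ 1 so V ≠ 0), with diameter d.
  record TDSystem (n d : ℕ) (A : Mat (suc n)) (E : Fin (suc d) → Mat (suc n))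
                  (A* : Mat (suc n)) (E* : Fin (suc d) → Mat (suc n))
                  (θ θ* : Fin (suc d) → Carrier) : Set (Level.suc (c ⊔ ℓ)) where
    field
      primA  : PrimitiveIdempotents A d E θ
      primA* : PrimitiveIdempotents A* d E* θ*
      tridiag  : ∀ i j → FarApart i j → (E i ∘M (A* ∘M E j)) ≈M 0M
      tridiag* : ∀ i j → FarApart i j → (E* i ∘M (A ∘M E* j)) ≈M 0M
      irreducible : ¬ (Σ (Vec (suc n) → Set (c ⊔ ℓ)) λ W →
                        IsSubspace W × Invariant A W × Invariant A* W ×
                        (∃ λ v → W v × ¬ (v ≈V 0V)) × (∃ λ v → ¬ W v))

  -- q-Serre type (with b = q²): θ_i = b θ_{i-1}, θ*_i = b⁻¹ θ*_{i-1}
  qSerreType : {d : ℕ} → (b b⁻¹ : Carrier) → (θ θ* : Fin (suc d) → Carrier) → Set ℓ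
  qSerreType {d} b b⁻¹ θ θ* =
    ∀ (i : Fin d) → (θ (suc i) ≈ b * θ (inject₁ i)) × (θ* (suc i) ≈ b⁻¹ * θ* (inject₁ i))

{-# OPTIONS --safe #-}
-- Compressing by the primitive idempotents of X turns q-commutators with X into scalars:
-- E_i [X,Y]_a E_j = (a θ_i - θ_j) E_i Y E_j, hence the block (i,j) of
-- [X,[X,[X,Y]_b]_{b⁻¹}] is (θ_i - θ_j)(b⁻¹θ_i - θ_j)(bθ_i - θ_j) E_i Y E_j. For a TD
-- system the block E_i A* E_j vanishes unless |i - j| ≤ 1, and in each of the cases
-- i = j, j = i + 1, i = j + 1 the q-Serre relation θ_{i+1} = b θ_i kills one of the
-- three factors; the dual relation follows in the same way with the roles of b and
-- b⁻¹ exchanged.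
module Submission where

open import Defs
open import Level using (Level)
open import Data.Nat using (ℕ; zero; suc; _≤_; z≤n; s≤s)
open import Data.Fin using (Fin; zero; suc; inject₁; punchIn; _≟_)
open import Data.Fin.Properties using (punchInᵢ≢i)
open import Data.Product using (_×_; _,_; proj₁; proj₂)
open import Data.Sum using (_⊎_; inj₁; inj₂)
open import Data.Empty using (⊥-elim)
open import Function using (_∘_)
open import Relation.Nullary using (¬_; yes; no)
open import Relation.Binary.Bundles using (Setoid)
import Relation.Binary.PropositionalEquality as ≡
import Relation.Binary.Reasoning.Setoid as SetoidReasoning
import Algebra.Properties.Ring as RingProperties
import Algebra.Properties.Semiring.Sum as SemiringSum

data Near {m : ℕ} : Fin (suc m) → Fin (suc m) → Set where
  same : ∀ i → Near i i
  up   : ∀ k → Near (inject₁ k) (suc k)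
  down : ∀ k → Near (suc k) (inject₁ k)

module FiniteSums {c ℓ : Level} (F : Field c ℓ) where
  open Field F hiding (zero)
  open FieldTheory F using (Σ[<_])
  open SemiringSum semiring
    using (sum; sum-cong-≋; sum-replicate-zero; sum-remove; ∑-distrib-+; ∑-comm;
           *-distribˡ-sum; *-distribʳ-sum)
  open RingProperties ring using (-1*x≈-x)
  open SetoidReasoning setoid

  Σ≈sum : ∀ {m} (f : Fin m → Carrier) → Σ[< m ] f ≈ sum f
  Σ≈sum {zero}  f = refl
  Σ≈sum {suc m} f = +-cong refl (Σ≈sum (f ∘ suc))

  Σ-cong : ∀ {m} {f g : Fin m → Carrier} → (∀ k → f k ≈ g k) → Σ[< m ] f ≈ Σ[< m ] g
  Σ-cong {f = f} {g} f≈g = trans (Σ≈sum f) (trans (sum-cong-≋ f≈g) (sym (Σ≈sum g)))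

  Σ-zero : ∀ {m} {f : Fin m → Carrier} → (∀ k → f k ≈ 0#) → Σ[< m ] f ≈ 0#
  Σ-zero {m} {f} f≈0 = trans (Σ≈sum f) (trans (sum-cong-≋ f≈0) (sum-replicate-zero m))

  Σ-single : ∀ {m} (i : Fin m) (f : Fin m → Carrier) →
             (∀ k → ¬ i ≡.≡ k → f k ≈ 0#) → Σ[< m ] f ≈ f i
  Σ-single {suc m} i f off = begin
    Σ[< suc m ] f             ≈⟨ Σ≈sum f ⟩
    sum f                     ≈⟨ sum-remove f ⟩
    f i + sum (f ∘ punchIn i)
      ≈⟨ +-cong refl (sum-zero (λ k → off (punchIn i k) (punchInᵢ≢i i k ∘ ≡.sym))) ⟩
    f i + 0#                  ≈⟨ +-identityʳ (f i) ⟩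
    f i                       ∎
    where
    sum-zero : ∀ {g : Fin m → Carrier} → (∀ k → g k ≈ 0#) → sum g ≈ 0#
    sum-zero g≈0 = trans (sum-cong-≋ g≈0) (sum-replicate-zero m)

  Σ-distrib-+ : ∀ {m} (f g : Fin m → Carrier) →
                Σ[< m ] (λ k → f k + g k) ≈ Σ[< m ] f + Σ[< m ] g
  Σ-distrib-+ f g = trans (Σ≈sum (λ k → f k + g k))
    (trans (∑-distrib-+ f g) (+-cong (sym (Σ≈sum f)) (sym (Σ≈sum g))))

  *-distribˡ-Σ : ∀ {m} a (f : Fin m → Carrier) → a * Σ[< m ] f ≈ Σ[< m ] (λ k → a * f k)
  *-distribˡ-Σ a f = trans (*-cong refl (Σ≈sum f))
    (trans (*-distribˡ-sum a f) (sym (Σ≈sum (λ k → a * f k))))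

  *-distribʳ-Σ : ∀ {m} a (f : Fin m → Carrier) → Σ[< m ] f * a ≈ Σ[< m ] (λ k → f k * a)
  *-distribʳ-Σ a f = trans (*-cong (Σ≈sum f) refl)
    (trans (*-distribʳ-sum a f) (sym (Σ≈sum (λ k → f k * a))))

  Σ-distrib-minus : ∀ {m} (f g : Fin m → Carrier) →
                Σ[< m ] (λ k → f k - g k) ≈ Σ[< m ] f - Σ[< m ] g
  Σ-distrib-minus {m} f g = begin
    Σ[< m ] (λ k → f k - g k)            ≈⟨ Σ-distrib-+ f (λ k → - g k) ⟩
    Σ[< m ] f + Σ[< m ] (λ k → - g k)    ≈⟨ +-cong refl (Σ-cong (λ k → sym (-1*x≈-x (g k)))) ⟩
    Σ[< m ] f + Σ[< m ] (λ k → - 1# * g k) ≈⟨ +-cong refl (sym (*-distribˡ-Σ (- 1#) g)) ⟩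
    Σ[< m ] f + - 1# * Σ[< m ] g         ≈⟨ +-cong refl (-1*x≈-x _) ⟩
    Σ[< m ] f - Σ[< m ] g                ∎

  Σ-comm : ∀ {m p} (f : Fin m → Fin p → Carrier) →
           Σ[< m ] (λ i → Σ[< p ] (f i)) ≈ Σ[< p ] (λ j → Σ[< m ] (λ i → f i j))
  Σ-comm {m} {p} f = begin
    Σ[< m ] (λ i → Σ[< p ] (f i))       ≈⟨ Σ-cong (λ i → Σ≈sum (f i)) ⟩
    Σ[< m ] (λ i → sum (f i))           ≈⟨ Σ≈sum (λ i → sum (f i)) ⟩
    sum (λ i → sum (f i))               ≈⟨ ∑-comm f ⟩
    sum (λ j → sum (λ i → f i j))       ≈⟨ Σ≈sum (λ j → sum (λ i → f i j)) ⟨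
    Σ[< p ] (λ j → sum (λ i → f i j))   ≈⟨ Σ-cong (λ j → Σ≈sum (λ i → f i j)) ⟨
    Σ[< p ] (λ j → Σ[< m ] (λ i → f i j)) ∎

module MatrixAlgebra {c ℓ : Level} (F : Field c ℓ) where
  open Field F hiding (zero)
  open FieldTheory F
  open FiniteSums F
  open RingProperties ring using (x[y-z]≈xy-xz; [y-z]x≈yx-zx)
  open SetoidReasoning setoid

  module _ {n : ℕ} where

    ≈M-setoid : Setoid c ℓ
    ≈M-setoid = record
      { Carrier       = Mat n
      ; _≈_           = _≈M_
      ; isEquivalence = record
        { refl  = λ _ _ → refl
        ; sym   = λ X≈Y i j → sym (X≈Y i j)
        ; trans = λ X≈Y Y≈Z i j → trans (X≈Y i j) (Y≈Z i j)
        }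
      }

    open Setoid ≈M-setoid public using ()
      renaming (refl to ≈M-refl; sym to ≈M-sym; trans to ≈M-trans)

    ∘M-cong : ∀ {X X′ Y Y′ : Mat n} → X ≈M X′ → Y ≈M Y′ → (X ∘M Y) ≈M (X′ ∘M Y′)
    ∘M-cong X≈X′ Y≈Y′ i j = Σ-cong (λ k → *-cong (X≈X′ i k) (Y≈Y′ k j))

    ∘M-congˡ : ∀ {X Y Y′ : Mat n} → Y ≈M Y′ → (X ∘M Y) ≈M (X ∘M Y′)
    ∘M-congˡ = ∘M-cong ≈M-refl

    ∘M-congʳ : ∀ {X X′ Y : Mat n} → X ≈M X′ → (X ∘M Y) ≈M (X′ ∘M Y)
    ∘M-congʳ X≈X′ = ∘M-cong X≈X′ ≈M-refl

    ∘M-assoc : ∀ (X Y Z : Mat n) → ((X ∘M Y) ∘M Z) ≈M (X ∘M (Y ∘M Z))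
    ∘M-assoc X Y Z i j = begin
      Σ[< n ] (λ l → Σ[< n ] (λ k → X i k * Y k l) * Z l j)
        ≈⟨ Σ-cong (λ l → *-distribʳ-Σ (Z l j) (λ k → X i k * Y k l)) ⟩
      Σ[< n ] (λ l → Σ[< n ] (λ k → (X i k * Y k l) * Z l j))
        ≈⟨ Σ-comm (λ l k → (X i k * Y k l) * Z l j) ⟩
      Σ[< n ] (λ k → Σ[< n ] (λ l → (X i k * Y k l) * Z l j))
        ≈⟨ Σ-cong (λ k → Σ-cong (λ l → *-assoc (X i k) (Y k l) (Z l j))) ⟩
      Σ[< n ] (λ k → Σ[< n ] (λ l → X i k * (Y k l * Z l j)))
        ≈⟨ Σ-cong (λ k → *-distribˡ-Σ (X i k) (λ l → Y k l * Z l j)) ⟨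
      Σ[< n ] (λ k → X i k * Σ[< n ] (λ l → Y k l * Z l j)) ∎

    ∘M-distribˡ-ΣM : ∀ m (X : Mat n) (f : Fin m → Mat n) →
                     (X ∘M ΣM m f) ≈M ΣM m (λ a → X ∘M f a)
    ∘M-distribˡ-ΣM m X f i j = begin
      Σ[< n ] (λ k → X i k * Σ[< m ] (λ a → f a k j))
        ≈⟨ Σ-cong (λ k → *-distribˡ-Σ (X i k) (λ a → f a k j)) ⟩
      Σ[< n ] (λ k → Σ[< m ] (λ a → X i k * f a k j))
        ≈⟨ Σ-comm (λ k a → X i k * f a k j) ⟩
      Σ[< m ] (λ a → Σ[< n ] (λ k → X i k * f a k j)) ∎

    ∘M-distribʳ-ΣM : ∀ m (X : Mat n) (f : Fin m → Mat n) →
                     (ΣM m f ∘M X) ≈M ΣM m (λ a → f a ∘M X)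
    ∘M-distribʳ-ΣM m X f i j = begin
      Σ[< n ] (λ k → Σ[< m ] (λ a → f a i k) * X k j)
        ≈⟨ Σ-cong (λ k → *-distribʳ-Σ (X k j) (λ a → f a i k)) ⟩
      Σ[< n ] (λ k → Σ[< m ] (λ a → f a i k * X k j))
        ≈⟨ Σ-comm (λ k a → f a i k * X k j) ⟩
      Σ[< m ] (λ a → Σ[< n ] (λ k → f a i k * X k j)) ∎

    X[Y-Z]≈XY-XZ : ∀ (X Y Z : Mat n) → (X ∘M (Y -M Z)) ≈M ((X ∘M Y) -M (X ∘M Z))
    X[Y-Z]≈XY-XZ X Y Z i j = trans (Σ-cong (λ k → x[y-z]≈xy-xz (X i k) (Y k j) (Z k j)))
                                   (Σ-distrib-minus (λ k → X i k * Y k j) (λ k → X i k * Z k j))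

    [Y-Z]X≈YX-ZX : ∀ (X Y Z : Mat n) → ((Y -M Z) ∘M X) ≈M ((Y ∘M X) -M (Z ∘M X))
    [Y-Z]X≈YX-ZX X Y Z i j = trans (Σ-cong (λ k → [y-z]x≈yx-zx (X k j) (Y i k) (Z i k)))
                                   (Σ-distrib-minus (λ k → Y i k * X k j) (λ k → Z i k * X k j))

    ·M-∘M-assoc : ∀ a (X Y : Mat n) → ((a ·M X) ∘M Y) ≈M (a ·M (X ∘M Y))
    ·M-∘M-assoc a X Y i j = trans (Σ-cong (λ k → *-assoc a (X i k) (Y k j)))
                                  (sym (*-distribˡ-Σ a (λ k → X i k * Y k j)))

    ∘M-·M-comm : ∀ a (X Y : Mat n) → (X ∘M (a ·M Y)) ≈M (a ·M (X ∘M Y))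
    ∘M-·M-comm a X Y i j = trans (Σ-cong (λ k → x[ay]≈a[xy] (X i k) (Y k j)))
                                 (sym (*-distribˡ-Σ a (λ k → X i k * Y k j)))
      where
      x[ay]≈a[xy] : ∀ x y → x * (a * y) ≈ a * (x * y)
      x[ay]≈a[xy] x y = trans (sym (*-assoc x a y))
                              (trans (*-cong (*-comm x a) refl) (*-assoc a x y))

    ·M-cong : ∀ {a b} {X Y : Mat n} → a ≈ b → X ≈M Y → (a ·M X) ≈M (b ·M Y)
    ·M-cong a≈b X≈Y i j = *-cong a≈b (X≈Y i j)

    -M-cong : ∀ {X X′ Y Y′ : Mat n} → X ≈M X′ → Y ≈M Y′ → (X -M Y) ≈M (X′ -M Y′)
    -M-cong X≈X′ Y≈Y′ i j = +-cong (X≈X′ i j) (-‿cong (Y≈Y′ i j))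

    [a-b]X≈aX-bX : ∀ a b (X : Mat n) → ((a - b) ·M X) ≈M ((a ·M X) -M (b ·M X))
    [a-b]X≈aX-bX a b X i j = [y-z]x≈yx-zx (X i j) a b

    ·M-assoc : ∀ a b (X : Mat n) → (a ·M (b ·M X)) ≈M ((a * b) ·M X)
    ·M-assoc a b X i j = sym (*-assoc a b (X i j))

    ·M-zeroˡ : ∀ {a} (X : Mat n) → a ≈ 0# → (a ·M X) ≈M 0M
    ·M-zeroˡ X a≈0 i j = trans (*-cong a≈0 refl) (zeroˡ (X i j))

    ·M-zeroʳ : ∀ a → (a ·M 0M) ≈M (0M {n})
    ·M-zeroʳ a i j = zeroʳ a

    ΣM-cong : ∀ {m} {f g : Fin m → Mat n} → (∀ a → f a ≈M g a) → ΣM m f ≈M ΣM m g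
    ΣM-cong f≈g i j = Σ-cong (λ a → f≈g a i j)

    ΣM-zero : ∀ m {f : Fin m → Mat n} → (∀ a → f a ≈M 0M) → ΣM m f ≈M 0M
    ΣM-zero m f≈0 i j = Σ-zero (λ a → f≈0 a i j)

    ΣM-single : ∀ m (a : Fin m) (f : Fin m → Mat n) →
                (∀ b → ¬ a ≡.≡ b → f b ≈M 0M) → ΣM m f ≈M f a
    ΣM-single m a f off i j = Σ-single a (λ b → f b i j) (λ b a≢b → off b a≢b i j)

    IM-diagonal : ∀ (i : Fin n) → IM i i ≈ 1#
    IM-diagonal i with i ≟ i
    ... | yes _  = refl
    ... | no i≢i = ⊥-elim (i≢i ≡.refl)

    IM-offDiagonal : ∀ (i k : Fin n) → ¬ i ≡.≡ k → IM i k ≈ 0#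
    IM-offDiagonal i k i≢k with i ≟ k
    ... | yes i≡k = ⊥-elim (i≢k i≡k)
    ... | no _    = refl

    ∘M-identityˡ : ∀ (X : Mat n) → (IM ∘M X) ≈M X
    ∘M-identityˡ X i j = begin
      Σ[< n ] (λ k → IM i k * X k j)
        ≈⟨ Σ-single i _ (λ k i≢k → trans (*-cong (IM-offDiagonal i k i≢k) refl) (zeroˡ _)) ⟩
      IM i i * X i j
        ≈⟨ trans (*-cong (IM-diagonal i) refl) (*-identityˡ _) ⟩
      X i j ∎

    ∘M-identityʳ : ∀ (X : Mat n) → (X ∘M IM) ≈M X
    ∘M-identityʳ X i j = begin
      Σ[< n ] (λ k → X i k * IM k j)
        ≈⟨ Σ-single j _ (λ k j≢k →
             trans (*-cong refl (IM-offDiagonal k j (j≢k ∘ ≡.sym))) (zeroʳ _)) ⟩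
      X i j * IM j j
        ≈⟨ trans (*-cong refl (IM-diagonal j)) (*-identityʳ _) ⟩
      X i j ∎

Near-suc : ∀ {m} {i j : Fin (suc m)} → Near i j → Near (suc i) (suc j)
Near-suc (same i) = same (suc i)
Near-suc (up k)   = up (suc k)
Near-suc (down k) = down (suc k)

module _ {c ℓ : Level} (F : Field c ℓ) where
  open Field F hiding (zero)
  open FieldTheory F
  open MatrixAlgebra F
  open RingProperties ring using (x≈y⇒x∙y⁻¹≈ε)

  farApart-or-near : ∀ {m} (i j : Fin (suc m)) → FarApart i j ⊎ Near i j
  farApart-or-near zero           zero           = inj₂ (same zero)
  farApart-or-near zero           (suc zero)     = inj₂ (up zero)
  farApart-or-near zero           (suc (suc j))  = inj₁ (inj₁ (s≤s (s≤s z≤n)))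
  farApart-or-near (suc zero)     zero           = inj₂ (down zero)
  farApart-or-near (suc (suc i))  zero           = inj₁ (inj₂ (s≤s (s≤s z≤n)))
  farApart-or-near {suc m} (suc i) (suc j) with farApart-or-near i j
  ... | inj₁ (inj₁ i+1<j) = inj₁ (inj₁ (s≤s i+1<j))
  ... | inj₁ (inj₂ j+1<i) = inj₁ (inj₂ (s≤s j+1<i))
  ... | inj₂ near         = inj₂ (Near-suc near)

  IsGeometric : ∀ {d} → Carrier → (Fin (suc d) → Carrier) → Set ℓ
  IsGeometric {d} r θ = ∀ (k : Fin d) → θ (suc k) ≈ r * θ (inject₁ k)

  serreFactor : (b b⁻¹ s t : Carrier) → Carrier
  serreFactor b b⁻¹ s t = (s - t) * ((b⁻¹ * s - t) * (b * s - t))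

  inverse-cancels : ∀ {u v s t} → u * v ≈ 1# → t ≈ v * s → u * t ≈ s
  inverse-cancels {u} {v} {s} uv≈1 t≈vs =
    trans (*-cong refl t≈vs)
      (trans (sym (*-assoc u v s)) (trans (*-cong uv≈1 refl) (*-identityˡ s)))

  factor₁ : ∀ {p q r} → p ≈ 0# → p * (q * r) ≈ 0#
  factor₁ p≈0 = trans (*-cong p≈0 refl) (zeroˡ _)

  factor₂ : ∀ {p q r} → q ≈ 0# → p * (q * r) ≈ 0#
  factor₂ q≈0 = trans (*-cong refl (trans (*-cong q≈0 refl) (zeroˡ _))) (zeroʳ _)

  factor₃ : ∀ {p q r} → r ≈ 0# → p * (q * r) ≈ 0#
  factor₃ r≈0 = trans (*-cong refl (trans (*-cong refl r≈0) (zeroʳ _))) (zeroʳ _)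

  serreFactor-near : ∀ {d b b⁻¹} {θ : Fin (suc d) → Carrier} → b⁻¹ * b ≈ 1# →
                     IsGeometric b θ ⊎ IsGeometric b⁻¹ θ →
                     ∀ {i j} → Near i j → serreFactor b b⁻¹ (θ i) (θ j) ≈ 0#
  serreFactor-near _      _        (same i) = factor₁ (x≈y⇒x∙y⁻¹≈ε refl)
  serreFactor-near _      (inj₁ g) (up k)   = factor₃ (x≈y⇒x∙y⁻¹≈ε (sym (g k)))
  serreFactor-near b⁻¹b≈1 (inj₁ g) (down k) =
    factor₂ (x≈y⇒x∙y⁻¹≈ε (inverse-cancels b⁻¹b≈1 (g k)))
  serreFactor-near _      (inj₂ g) (up k)   = factor₂ (x≈y⇒x∙y⁻¹≈ε (sym (g k)))
  serreFactor-near b⁻¹b≈1 (inj₂ g) (down k) =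
    factor₃ (x≈y⇒x∙y⁻¹≈ε (inverse-cancels (trans (*-comm _ _) b⁻¹b≈1) (g k)))

  module _ {n d : ℕ} {X : Mat n} {E : Fin (suc d) → Mat n} {θ : Fin (suc d) → Carrier}
           (prim : PrimitiveIdempotents X d E θ) where
    open PrimitiveIdempotents prim
    open SetoidReasoning (≈M-setoid {n})

    EᵢX≈θᵢEᵢ : ∀ i → (E i ∘M X) ≈M (θ i ·M E i)
    EᵢX≈θᵢEᵢ i = begin
      E i ∘M X                               ≈⟨ ∘M-congˡ spectral ⟩
      E i ∘M ΣM (suc d) (λ k → θ k ·M E k)   ≈⟨ ∘M-distribˡ-ΣM (suc d) (E i) (λ k → θ k ·M E k) ⟩
      ΣM (suc d) (λ k → E i ∘M (θ k ·M E k)) ≈⟨ ΣM-single (suc d) i _ off-diagonal ⟩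
      E i ∘M (θ i ·M E i)                    ≈⟨ ∘M-·M-comm (θ i) (E i) (E i) ⟩
      θ i ·M (E i ∘M E i)                    ≈⟨ ·M-cong refl (idem i) ⟩
      θ i ·M E i                             ∎
      where
      off-diagonal : ∀ k → ¬ i ≡.≡ k → (E i ∘M (θ k ·M E k)) ≈M 0M
      off-diagonal k i≢k = ≈M-trans (∘M-·M-comm (θ k) (E i) (E k))
                             (≈M-trans (·M-cong refl (orth i k i≢k)) (·M-zeroʳ (θ k)))

    XEⱼ≈θⱼEⱼ : ∀ j → (X ∘M E j) ≈M (θ j ·M E j)
    XEⱼ≈θⱼEⱼ j = begin
      X ∘M E j                               ≈⟨ ∘M-congʳ spectral ⟩
      ΣM (suc d) (λ k → θ k ·M E k) ∘M E j   ≈⟨ ∘M-distribʳ-ΣM (suc d) (E j) (λ k → θ k ·M E k) ⟩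
      ΣM (suc d) (λ k → (θ k ·M E k) ∘M E j) ≈⟨ ΣM-single (suc d) j _ off-diagonal ⟩
      (θ j ·M E j) ∘M E j                    ≈⟨ ·M-∘M-assoc (θ j) (E j) (E j) ⟩
      θ j ·M (E j ∘M E j)                    ≈⟨ ·M-cong refl (idem j) ⟩
      θ j ·M E j                             ∎
      where
      off-diagonal : ∀ k → ¬ j ≡.≡ k → ((θ k ·M E k) ∘M E j) ≈M 0M
      off-diagonal k j≢k = ≈M-trans (·M-∘M-assoc (θ k) (E k) (E j))
                             (≈M-trans (·M-cong refl (orth k j (j≢k ∘ ≡.sym))) (·M-zeroʳ (θ k)))

    block : Mat n → Fin (suc d) → Fin (suc d) → Mat n
    block Y i j = E i ∘M (Y ∘M E j)

    block-cong : ∀ {Y Y′} i j → Y ≈M Y′ → block Y i j ≈M block Y′ i j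
    block-cong i j Y≈Y′ = ∘M-congˡ (∘M-congʳ Y≈Y′)

    block-XY : ∀ Y i j → block (X ∘M Y) i j ≈M (θ i ·M block Y i j)
    block-XY Y i j = begin
      E i ∘M ((X ∘M Y) ∘M E j)   ≈⟨ ∘M-congˡ (∘M-assoc X Y (E j)) ⟩
      E i ∘M (X ∘M (Y ∘M E j))   ≈⟨ ∘M-assoc (E i) X (Y ∘M E j) ⟨
      (E i ∘M X) ∘M (Y ∘M E j)   ≈⟨ ∘M-congʳ (EᵢX≈θᵢEᵢ i) ⟩
      (θ i ·M E i) ∘M (Y ∘M E j) ≈⟨ ·M-∘M-assoc (θ i) (E i) (Y ∘M E j) ⟩
      θ i ·M block Y i j         ∎

    block-YX : ∀ Y i j → block (Y ∘M X) i j ≈M (θ j ·M block Y i j)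
    block-YX Y i j = begin
      E i ∘M ((Y ∘M X) ∘M E j)   ≈⟨ ∘M-congˡ (∘M-assoc Y X (E j)) ⟩
      E i ∘M (Y ∘M (X ∘M E j))   ≈⟨ ∘M-congˡ (∘M-congˡ (XEⱼ≈θⱼEⱼ j)) ⟩
      E i ∘M (Y ∘M (θ j ·M E j)) ≈⟨ ∘M-congˡ (∘M-·M-comm (θ j) Y (E j)) ⟩
      E i ∘M (θ j ·M (Y ∘M E j)) ≈⟨ ∘M-·M-comm (θ j) (E i) (Y ∘M E j) ⟩
      θ j ·M block Y i j         ∎

    block-q-commutator : ∀ a Y i j →
                         block [ X , Y ]⟨ a ⟩ i j ≈M ((a * θ i - θ j) ·M block Y i j)
    block-q-commutator a Y i j = begin
      E i ∘M (((a ·M (X ∘M Y)) -M (Y ∘M X)) ∘M E j)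
        ≈⟨ ∘M-congˡ ([Y-Z]X≈YX-ZX (E j) (a ·M (X ∘M Y)) (Y ∘M X)) ⟩
      E i ∘M (((a ·M (X ∘M Y)) ∘M E j) -M ((Y ∘M X) ∘M E j))
        ≈⟨ X[Y-Z]≈XY-XZ (E i) ((a ·M (X ∘M Y)) ∘M E j) ((Y ∘M X) ∘M E j) ⟩
      block (a ·M (X ∘M Y)) i j -M block (Y ∘M X) i j
        ≈⟨ -M-cong (≈M-trans (∘M-congˡ (·M-∘M-assoc a (X ∘M Y) (E j))) (∘M-·M-comm a (E i) _))
                   (block-YX Y i j) ⟩
      (a ·M block (X ∘M Y) i j) -M (θ j ·M block Y i j)
        ≈⟨ -M-cong (≈M-trans (·M-cong refl (block-XY Y i j)) (·M-assoc a (θ i) _)) ≈M-refl ⟩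
      ((a * θ i) ·M block Y i j) -M (θ j ·M block Y i j)
        ≈⟨ [a-b]X≈aX-bX (a * θ i) (θ j) (block Y i j) ⟨
      (a * θ i - θ j) ·M block Y i j ∎

    block-commutator : ∀ Y i j → block [ X , Y ] i j ≈M ((θ i - θ j) ·M block Y i j)
    block-commutator Y i j = begin
      block [ X , Y ] i j              ≈⟨ block-cong i j (λ k l → +-cong (sym (*-identityˡ _)) refl) ⟩
      block [ X , Y ]⟨ 1# ⟩ i j        ≈⟨ block-q-commutator 1# Y i j ⟩
      (1# * θ i - θ j) ·M block Y i j  ≈⟨ ·M-cong (+-cong (*-identityˡ (θ i)) refl) ≈M-refl ⟩
      (θ i - θ j) ·M block Y i j       ∎

    block-serre : ∀ b b⁻¹ Y i j →
      block [ X , [ X , [ X , Y ]⟨ b ⟩ ]⟨ b⁻¹ ⟩ ] i j ≈M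
      (serreFactor b b⁻¹ (θ i) (θ j) ·M block Y i j)
    block-serre b b⁻¹ Y i j = begin
      block [ X , [ X , [ X , Y ]⟨ b ⟩ ]⟨ b⁻¹ ⟩ ] i j
        ≈⟨ block-commutator _ i j ⟩
      (θ i - θ j) ·M block [ X , [ X , Y ]⟨ b ⟩ ]⟨ b⁻¹ ⟩ i j
        ≈⟨ ·M-cong refl (block-q-commutator b⁻¹ _ i j) ⟩
      (θ i - θ j) ·M ((b⁻¹ * θ i - θ j) ·M block [ X , Y ]⟨ b ⟩ i j)
        ≈⟨ ·M-cong refl (·M-cong refl (block-q-commutator b Y i j)) ⟩
      (θ i - θ j) ·M ((b⁻¹ * θ i - θ j) ·M ((b * θ i - θ j) ·M block Y i j))
        ≈⟨ ·M-cong refl (·M-assoc _ _ _) ⟩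
      (θ i - θ j) ·M (((b⁻¹ * θ i - θ j) * (b * θ i - θ j)) ·M block Y i j)
        ≈⟨ ·M-assoc _ _ _ ⟩
      serreFactor b b⁻¹ (θ i) (θ j) ·M block Y i j ∎

    sum-of-blocks : ∀ Y → Y ≈M ΣM (suc d) (λ i → ΣM (suc d) (λ j → block Y i j))
    sum-of-blocks Y = begin
      Y                                        ≈⟨ ∘M-identityˡ Y ⟨
      IM ∘M Y                                  ≈⟨ ∘M-congˡ (∘M-identityʳ Y) ⟨
      IM ∘M (Y ∘M IM)
        ≈⟨ ∘M-cong (≈M-sym resolution) (∘M-congˡ (≈M-sym resolution)) ⟩
      ΣM (suc d) E ∘M (Y ∘M ΣM (suc d) E)      ≈⟨ ∘M-distribʳ-ΣM (suc d) _ E ⟩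
      ΣM (suc d) (λ i → E i ∘M (Y ∘M ΣM (suc d) E))
        ≈⟨ ΣM-cong (λ i → ≈M-trans (∘M-congˡ (∘M-distribˡ-ΣM (suc d) Y E))
                                   (∘M-distribˡ-ΣM (suc d) (E i) (λ j → Y ∘M E j))) ⟩
      ΣM (suc d) (λ i → ΣM (suc d) (λ j → block Y i j)) ∎

    blocks-zero⇒zero : ∀ {Y} → (∀ i j → block Y i j ≈M 0M) → Y ≈M 0M
    blocks-zero⇒zero {Y} blocks≈0 =
      ≈M-trans (sum-of-blocks Y) (ΣM-zero (suc d) (λ i → ΣM-zero (suc d) (blocks≈0 i)))

    serre-relation : ∀ (Y : Mat n) {b b⁻¹ : Carrier} →
      (∀ i j → FarApart i j → block Y i j ≈M 0M) → b⁻¹ * b ≈ 1# →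
      IsGeometric b θ ⊎ IsGeometric b⁻¹ θ →
      [ X , [ X , [ X , Y ]⟨ b ⟩ ]⟨ b⁻¹ ⟩ ] ≈M 0M
    serre-relation Y {b} {b⁻¹} tridiagonal b⁻¹b≈1 geometric = blocks-zero⇒zero λ i j →
      ≈M-trans (block-serre b b⁻¹ Y i j) (vanishes i j (farApart-or-near i j))
      where
      vanishes : ∀ i j → FarApart i j ⊎ Near i j →
                 (serreFactor b b⁻¹ (θ i) (θ j) ·M block Y i j) ≈M 0M
      vanishes i j (inj₁ far)  = ≈M-trans (·M-cong refl (tridiagonal i j far)) (·M-zeroʳ _)
      vanishes i j (inj₂ near) = ·M-zeroˡ _ (serreFactor-near b⁻¹b≈1 geometric near)

lemma9p2 : ∀ {c ℓ : Level} (F : Field c ℓ) →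
    let open Field F
        open FieldTheory F
    in (b b⁻¹ : Carrier) → ¬ (b ≈ 0#) → (b * b⁻¹) ≈ 1# →
       (∀ (k : ℕ) → 1 ≤ k → ¬ ((b ^ k) ≈ 1#)) →
       (n d : ℕ) → 1 ≤ d →
       (A A* : Mat (suc n)) (E E* : Fin (suc d) → Mat (suc n))
       (θ θ* : Fin (suc d) → Carrier) →
       TDSystem n d A E A* E* θ θ* →
       qSerreType b b⁻¹ θ θ* →
       ([ A , [ A , [ A , A* ]⟨ b ⟩ ]⟨ b⁻¹ ⟩ ] ≈M 0M) ×
       ([ A* , [ A* , [ A* , A ]⟨ b ⟩ ]⟨ b⁻¹ ⟩ ] ≈M 0M)
lemma9p2 F b b⁻¹ _ bb⁻¹≈1 _ n d _ A A* E E* θ θ* tdSystem qSerre =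
  serre-relation F primA  A* tridiag  b⁻¹b≈1 (inj₁ (proj₁ ∘ qSerre)) ,
  serre-relation F primA* A  tridiag* b⁻¹b≈1 (inj₂ (proj₂ ∘ qSerre))
  where
  open Field F using (_*_; _≈_; 1#; trans; *-comm)
  open FieldTheory.TDSystem tdSystem

  b⁻¹b≈1 : b⁻¹ * b ≈ 1#
  b⁻¹b≈1 = trans (*-comm b⁻¹ b) bb⁻¹≈1
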